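{- For every $k\in\mathbb N$, $\mathcal I(k)\supset(\mathcal I_L)^k$.
   Context: $K$ is a number field with ring of integers $\mathcal O_K$, $G$ an algebraic group over $K$ embedded in $\mathbb P^N$, $\overline G$ its Zariski closure, $U=\overline G\cap\{X_0\neq0\}$, $\xi_i=(X_i/X_0)|_U$ ($i=1,\ldots,N$); the algebra $K[\xi_1,\ldots,\xi_N]$ is stable under derivations in $\mathfrak g=\operatorname{Lie}(G)$. $L:\{1,\ldots,n\}\to\mathfrak g$ is a basis, and $L(j)\xi_i=P_{i,L(j)}(\xi_1,\ldots,\xi_N)$ with $P_{i,L(j)}\in K[T_1,\ldots,T_N]$. Let $\mathcal L=\sum_{j=1}^nL(j)(\mathcal O_K[\xi_1,\ldots,\xi_N])$ and $\mathcal I_L=\{a\in\mathcal O_K:a\mathcal L\subset\mathcal O_K[\xi_1,\ldots,\xi_N]\}$. For $t\in\mathbb N^n$ write $L^t=L(1)^{t_1}\cdots L(n)^{t_n}$ and $|t|=t_1+\cdots+t_n$. For $k\in\mathbb N$ let $\mathcal L(k)=\sum_{|t|\leq k}L^t(\mathcal O_K[\xi_1,\ldots,\xi_N])$ and $\mathcal I(k)=\{a\in\mathcal O_K:a\mathcal L(k)\subset\mathcal O_K[\xi_1,\ldots,\xi_N]\}$. -}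

module Defs where

open import Level using (Level; _⊔_)
open import Data.Nat using (ℕ; zero; suc) renaming (_+_ to _+ℕ_; _≤_ to _≤ℕ_)
open import Data.Fin using (Fin; zero; suc)
open import Data.Product using (_×_; Σ)
open import Function using (_∘_)
open import Relation.Nullary using (¬_)
open import Algebra.Bundles using (CommutativeRing)

iter : ∀ {a} {A : Set a} → ℕ → (A → A) → A → A
iter zero    g x = x
iter (suc m) g x = g (iter m g x)

compPow : ∀ {a} {A : Set a} (n : ℕ) → (Fin n → A → A) → (Fin n → ℕ) → A → A
compPow zero    L t x = x
compPow (suc n) L t x = iter (t zero) (L zero) (compPow n (L ∘ suc) (t ∘ suc) x)

weight : (n : ℕ) → (Fin n → ℕ) → ℕ
weight zero    t = 0
weight (suc n) t = t zero +ℕ weight n (t ∘ suc)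

module _ {c ℓ : Level} (R : CommutativeRing c ℓ) where
  open CommutativeRing R

  data InAlg (S : Carrier → Set (c ⊔ ℓ)) {N : ℕ} (ξ : Fin N → Carrier)
       : Carrier → Set (c ⊔ ℓ) where
    coef : ∀ {x} → S x → InAlg S ξ x
    var  : ∀ i → InAlg S ξ (ξ i)
    add  : ∀ {x y} → InAlg S ξ x → InAlg S ξ y → InAlg S ξ (x + y)
    mul  : ∀ {x y} → InAlg S ξ x → InAlg S ξ y → InAlg S ξ (x * y)
    resp : ∀ {x y} → x ≈ y → InAlg S ξ x → InAlg S ξ y

  data IdealProd (I J : Carrier → Set (c ⊔ ℓ)) : Carrier → Set (c ⊔ ℓ) where
    zer  : IdealProd I J 0#
    prod : ∀ {i j} → I i → J j → IdealProd I J (i * j)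
    add  : ∀ {x y} → IdealProd I J x → IdealProd I J y → IdealProd I J (x + y)
    resp : ∀ {x y} → x ≈ y → IdealProd I J x → IdealProd I J y

  IdealPow : (O I : Carrier → Set (c ⊔ ℓ)) → ℕ → Carrier → Set (c ⊔ ℓ)
  IdealPow O I zero    = O
  IdealPow O I (suc k) = IdealProd I (IdealPow O I k)

  record IsSubring (S : Carrier → Set (c ⊔ ℓ)) : Set (c ⊔ ℓ) where
    field
      resp≈ : ∀ {x y} → x ≈ y → S x → S y
      has0  : S 0#
      has1  : S 1#
      +-cl  : ∀ {x y} → S x → S y → S (x + y)
      *-cl  : ∀ {x y} → S x → S y → S (x * y)
      neg-cl : ∀ {x} → S x → S (- x)

  record IsSubfield (S : Carrier → Set (c ⊔ ℓ)) : Set (c ⊔ ℓ) where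
    field
      isSubring : IsSubring S
      nontriv   : ¬ (1# ≈ 0#)
      inv       : ∀ {x} → S x → ¬ (x ≈ 0#) → Σ Carrier (λ y → S y × (x * y ≈ 1#))

  record IsKDerivation (K : Carrier → Set (c ⊔ ℓ)) (D : Carrier → Carrier) : Set (c ⊔ ℓ) where
    field
      cong     : ∀ {x y} → x ≈ y → D x ≈ D y
      additive : ∀ x y → D (x + y) ≈ D x + D y
      leibniz  : ∀ x y → D (x * y) ≈ x * D y + y * D x
      kills-K  : ∀ {x} → K x → D x ≈ 0#

record Setting (c ℓ : Level) : Set (Level.suc (c ⊔ ℓ)) where
  field
    R     : CommutativeRing c ℓ          -- ambient ring of functions on U
  open CommutativeRing R public
  field
    K     : Carrier → Set (c ⊔ ℓ)        -- the number field K (constants)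
    OK    : Carrier → Set (c ⊔ ℓ)
    K-field  : IsSubfield R K
    OK-ring  : IsSubring R OK
    OK⊆K     : ∀ {x} → OK x → K x
    N     : ℕ
    ξ     : Fin N → Carrier              -- ξ_i = X_i / X_0 restricted to U
    n     : ℕ
    L     : Fin n → Carrier → Carrier    -- the basis L(1),…,L(n) of 𝔤
    L-der : ∀ j → IsKDerivation R K (L j)
    stable : ∀ j {f} → InAlg R K ξ f → InAlg R K ξ (L j f)

  A : Carrier → Set (c ⊔ ℓ)
  A = InAlg R OK ξ

  data 𝓛₁ : Carrier → Set (c ⊔ ℓ) where
    zer  : 𝓛₁ 0#
    gen  : ∀ j {f} → A f → 𝓛₁ (L j f)
    add  : ∀ {x y} → 𝓛₁ x → 𝓛₁ y → 𝓛₁ (x + y)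
    resp : ∀ {x y} → x ≈ y → 𝓛₁ x → 𝓛₁ y

  𝓘L : Carrier → Set (c ⊔ ℓ)
  𝓘L a = OK a × (∀ {x} → 𝓛₁ x → A (a * x))

  Lpow : (Fin n → ℕ) → Carrier → Carrier
  Lpow t = compPow n L t

  data 𝓛 (k : ℕ) : Carrier → Set (c ⊔ ℓ) where
    zer  : 𝓛 k 0#
    gen  : ∀ (t : Fin n → ℕ) → weight n t ≤ℕ k → ∀ {f} → A f → 𝓛 k (Lpow t f)
    add  : ∀ {x y} → 𝓛 k x → 𝓛 k y → 𝓛 k (x + y)
    resp : ∀ {x y} → x ≈ y → 𝓛 k x → 𝓛 k y

  𝓘 : ℕ → Carrier → Set (c ⊔ ℓ)
  𝓘 k a = OK a × (∀ {x} → 𝓛 k x → A (a * x))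

  𝓘L^ : ℕ → Carrier → Set (c ⊔ ℓ)
  𝓘L^ k = IdealPow R OK 𝓘L k

{-# OPTIONS --safe #-}
module Submission where

-- For i ∈ 𝓘_L and j ∈ 𝓘(k), the product i j kills the denominators of
-- every L^t f with |t| ≤ k + 1: if |t| ≤ k this is already done by j, and otherwise
-- L^t = L(m) ∘ L^{t'} with |t'| = k, so that i j L^t f = i L(m)(j L^{t'} f) because the
-- derivation L(m) is linear over the constant j; here j L^{t'} f ∈ O_K[ξ], hence
-- L(m)(j L^{t'} f) ∈ 𝓛, and i maps it into O_K[ξ].

open import Defs
open import Level using (Level)
open import Data.Nat using (ℕ; zero; suc; _≤_; s≤s⁻¹)
open import Data.Nat.Properties using (suc-injective; n≤0⇒n≡0; m≤n⇒m<n∨m≡n; ≤-reflexive)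
open import Data.Fin using (Fin; zero; suc)
open import Data.Product using (Σ-syntax; _×_; _,_)
open import Data.Sum using (inj₁; inj₂)
open import Function using (_∘_)
open import Algebra.Bundles using (CommutativeRing)
open import Relation.Binary.PropositionalEquality using (_≡_; refl)
import Relation.Binary.Reasoning.Setoid as SetoidReasoning

compPow-weight-zero : ∀ {a} {X : Set a} n (L : Fin n → X → X) t →
                      weight n t ≡ 0 → ∀ x → compPow n L t x ≡ x
compPow-weight-zero zero    L t _ x = refl
compPow-weight-zero (suc n) L t w≡0 x with t zero
... | zero = compPow-weight-zero n (L ∘ suc) (t ∘ suc) w≡0 x

compPow-weight-suc : ∀ {a} {X : Set a} n (L : Fin n → X → X) t {w} → weight n t ≡ suc w →
                     Σ[ m ∈ Fin n ] Σ[ t′ ∈ (Fin n → ℕ) ]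
                       weight n t′ ≡ w × (∀ x → compPow n L t x ≡ L m (compPow n L t′ x))
compPow-weight-suc zero    L t ()
compPow-weight-suc (suc n) L t w≡1+w′ with t zero
... | suc s = zero , (λ { zero → s ; (suc i) → t (suc i) }) , suc-injective w≡1+w′ , λ _ → refl
... | zero with compPow-weight-suc n (L ∘ suc) (t ∘ suc) w≡1+w′
...   | m , t′ , wt′ , split = suc m , (λ { zero → 0 ; (suc i) → t′ i }) , wt′ , split

module _ {c ℓ : Level} (R : CommutativeRing c ℓ) where
  open CommutativeRing R
  open SetoidReasoning setoid

  IsKDerivation-linear : ∀ {K D} → IsKDerivation R K D → ∀ {κ} → K κ → ∀ x → D (κ * x) ≈ κ * D x
  IsKDerivation-linear {D = D} der {κ} Kκ x = begin
    D (κ * x)             ≈⟨ leibniz κ x ⟩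
    κ * D x + x * D κ     ≈⟨ +-congˡ (*-congˡ (kills-K Kκ)) ⟩
    κ * D x + x * 0#      ≈⟨ +-congˡ (zeroʳ x) ⟩
    κ * D x + 0#          ≈⟨ +-identityʳ _ ⟩
    κ * D x               ∎
    where open IsKDerivation der

  IdealProd-⊆ : ∀ {I J} {p} (P : Carrier → Set p) →
                P 0# → (∀ {x y} → P x → P y → P (x + y)) → (∀ {x y} → x ≈ y → P x → P y) →
                (∀ {i j} → I i → J j → P (i * j)) → ∀ {x} → IdealProd R I J x → P x
  IdealProd-⊆ P P0 P+ P≈ P* zer          = P0
  IdealProd-⊆ P P0 P+ P≈ P* (prod Ii Jj) = P* Ii Jj
  IdealProd-⊆ P P0 P+ P≈ P* (add x y)    =
    P+ (IdealProd-⊆ P P0 P+ P≈ P* x) (IdealProd-⊆ P P0 P+ P≈ P* y)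
  IdealProd-⊆ P P0 P+ P≈ P* (resp x≈y x) = P≈ x≈y (IdealProd-⊆ P P0 P+ P≈ P* x)

module _ {c ℓ : Level} (S : Setting c ℓ) where
  open Setting S
  open IsSubring OK-ring
  open SetoidReasoning setoid

  multiplier-on-generators : ∀ k {a} → (∀ t → weight n t ≤ k → ∀ {f} → A f → A (a * Lpow t f)) →
                             ∀ {x} → 𝓛 k x → A (a * x)
  multiplier-on-generators k gen⇒A zer          = InAlg.resp (sym (zeroʳ _)) (InAlg.coef has0)
  multiplier-on-generators k gen⇒A (gen t wt Af) = gen⇒A t wt Af
  multiplier-on-generators k gen⇒A (add x y)    = InAlg.resp (sym (distribˡ _ _ _))
    (InAlg.add (multiplier-on-generators k gen⇒A x) (multiplier-on-generators k gen⇒A y))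
  multiplier-on-generators k gen⇒A (resp x≈y x) =
    InAlg.resp (*-congˡ x≈y) (multiplier-on-generators k gen⇒A x)

  𝓘-0# : ∀ k → 𝓘 k 0#
  𝓘-0# k = has0 , λ _ → InAlg.resp (sym (zeroˡ _)) (InAlg.coef has0)

  𝓘-+ : ∀ k {a b} → 𝓘 k a → 𝓘 k b → 𝓘 k (a + b)
  𝓘-+ k (OKa , a𝓛) (OKb , b𝓛) =
    +-cl OKa OKb , λ x → InAlg.resp (sym (distribʳ _ _ _)) (InAlg.add (a𝓛 x) (b𝓛 x))

  𝓘-resp : ∀ k {a b} → a ≈ b → 𝓘 k a → 𝓘 k b
  𝓘-resp k a≈b (OKa , a𝓛) = resp≈ a≈b OKa , λ x → InAlg.resp (*-congʳ a≈b) (a𝓛 x)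

  OK⊆𝓘0 : ∀ {a} → OK a → 𝓘 0 a
  OK⊆𝓘0 {a} OKa = OKa , multiplier-on-generators 0 λ t wt {f} Af →
    InAlg.resp (*-congˡ (sym (reflexive (compPow-weight-zero n L t (n≤0⇒n≡0 wt) f))))
               (InAlg.mul (InAlg.coef OKa) Af)

  𝓘L*𝓘⊆𝓘-suc : ∀ k {i j} → 𝓘L i → 𝓘 k j → 𝓘 (suc k) (i * j)
  𝓘L*𝓘⊆𝓘-suc k {i} {j} (OKi , i𝓛₁) (OKj , j𝓛) =
    *-cl OKi OKj , multiplier-on-generators (suc k) kills-generator
    where
    kills-generator : ∀ t → weight n t ≤ suc k → ∀ {f} → A f → A (i * j * Lpow t f)
    kills-generator t wt {f} Af with m≤n⇒m<n∨m≡n wt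
    ... | inj₁ wt<1+k = InAlg.resp (sym (*-assoc _ _ _))
                          (InAlg.mul (InAlg.coef OKi) (j𝓛 (gen t (s≤s⁻¹ wt<1+k) Af)))
    ... | inj₂ wt≡1+k with compPow-weight-suc n L t wt≡1+k
    ...   | m , t′ , wt′≡k , split = InAlg.resp i·Lm[jy]≈ij·Ltf (i𝓛₁ (gen m jy∈A))
      where
      y = Lpow t′ f
      jy∈A : A (j * y)
      jy∈A = j𝓛 (gen t′ (≤-reflexive wt′≡k) Af)
      i·Lm[jy]≈ij·Ltf : i * L m (j * y) ≈ i * j * Lpow t f
      i·Lm[jy]≈ij·Ltf = begin
        i * L m (j * y)   ≈⟨ *-congˡ (IsKDerivation-linear R (L-der m) (OK⊆K OKj) y) ⟩
        i * (j * L m y)   ≈⟨ sym (*-assoc i j _) ⟩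
        i * j * L m y     ≈⟨ *-congˡ (reflexive (split f)) ⟨
        i * j * Lpow t f  ∎

lemma3p10 : ∀ {c ℓ : Level} (S : Setting c ℓ) (k : ℕ) {a : Setting.Carrier S} →
    Setting.𝓘L^ S k a → Setting.𝓘 S k a
lemma3p10 S zero    OKa = OK⊆𝓘0 S OKa
lemma3p10 S (suc k) a∈𝓘L^k+1 =
  IdealProd-⊆ R (𝓘 (suc k)) (𝓘-0# S (suc k)) (𝓘-+ S (suc k)) (𝓘-resp S (suc k))
    (λ i∈𝓘L j∈𝓘L^k → 𝓘L*𝓘⊆𝓘-suc S k i∈𝓘L (lemma3p10 S k j∈𝓘L^k))
    a∈𝓘L^k+1
  where open Setting S
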